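{- For $n\ge1$ and $1\le k\le n$, $$a(n,k)=a(n-1,k-1)+\lceil k/2\rceil\,a(n-1,k),$$ with boundary conditions $a(n,0)=\delta_{n,0}$ (and $a(n,k)=0$ for $k>n$).
   Context: An RG-word of length $n$ with maximum letter $k$ is a word $w_1\cdots w_n$ of positive integers with $w_1=1$, $w_i\le\max(w_1,\dots,w_{i-1})+1$ for $i\ge2$, and $\max_iw_i=k$ (the empty word is the unique such word with $n=k=0$). It is allowable if every even letter in it occurs exactly once. $a(n,k)$ denotes the number of allowable RG-words of length $n$ with maximum letter $k$ (equivalently, set partitions of $\{1,\dots,n\}$ into $k$ blocks, ordered by their minima, in which every even-indexed block is a singleton). -}

module Defs where

open import Data.Nat using (ℕ; zero; suc; _+_; _*_; _⊔_; _≤ᵇ_; _≡ᵇ_; _/_)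
open import Data.Bool using (Bool; true; false; _∧_; not)
open import Data.List using (List; []; _∷_; length; filter; map; concatMap; foldr; reverse)
open import Data.Nat using (_≟_)
open import Relation.Binary.PropositionalEquality using (_≡_)
open import Relation.Nullary.Decidable using (Dec)

-- Words are lists of natural numbers (letters are meant to be positive).

maxLetter : List ℕ → ℕ
maxLetter = foldr _⊔_ 0

-- RG condition checked left to right, given the running maximum m of the prefix.
rgFrom : ℕ → List ℕ → Bool
rgFrom m []       = true
rgFrom m (w ∷ ws) = (1 ≤ᵇ w) ∧ (w ≤ᵇ suc m) ∧ rgFrom (m ⊔ w) ws

isRG : List ℕ → Bool
isRG []       = true
isRG (w ∷ ws) = (w ≡ᵇ 1) ∧ rgFrom w ws

occ : ℕ → List ℕ → ℕ
occ x []       = 0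
occ x (y ∷ ys) with x ≡ᵇ y
... | true  = suc (occ x ys)
... | false = occ x ys

even : ℕ → Bool
even zero          = true
even (suc zero)    = false
even (suc (suc n)) = even n

allEvenOnce : List ℕ → List ℕ → Bool
allEvenOnce w []       = true
allEvenOnce w (x ∷ xs) = (not (even x) Data.Bool.∨ (occ x w ≡ᵇ 1)) ∧ allEvenOnce w xs

isAllowable : List ℕ → Bool
isAllowable w = isRG w ∧ allEvenOnce w w


letters : ℕ → List ℕ
letters b = map suc (Data.List.upTo b)

wordsOver : ℕ → ℕ → List (List ℕ)
wordsOver b zero    = [] ∷ []
wordsOver b (suc n) = concatMap (λ x → map (x ∷_) (wordsOver b n)) (letters b)

-- a(n,k): number of allowable RG-words of length n with maximum letter k.
-- Every RG-word of length n has all letters in {1,…,n}, so enumerating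
-- wordsOver n n covers all of them.
a : ℕ → ℕ → ℕ
a n k = length (filter (λ w → Data.Bool.T? (isAllowable w ∧ (maxLetter w ≡ᵇ k))) (wordsOver n n))

ceilHalf : ℕ → ℕ
ceilHalf k = (suc k) / 2

module Submission where

-- Every word of length n+1 is uniquely w ++ [x] with |w| = n.
-- If M is the maximum letter of w, then w ++ [x] is an allowable RG-word
-- exactly when w is one and either x = M+1 (a new block) or x ≤ M is odd
-- (an odd letter may repeat; an even letter already in w may not).  Among 1,…,M there are ⌈M/2⌉ odd
-- letters and the new maximum is M+1 resp. M (count-extensions), so summing
-- over w gives  #(n+1, k) = #(n, k-1) + ⌈k/2⌉ · #(n, k).
-- Since a(n,k) enumerates words over the alphabet {1,…,n}, which moves with n,
-- we count over an arbitrary alphabet {1,…,b} with b ≥ n (an RG-word of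
-- length n never uses a letter above n) and show that the count equals the
-- triangle A n k defined by the recurrence itself (count-allowable).

open import Defs
open import Data.Nat using (ℕ; zero; suc; _+_; _*_; _≤_; _<_; _∸_; _⊔_; _≤ᵇ_; _≡ᵇ_; z≤n; s≤s; _≟_)
open import Data.Nat.Properties
open import Data.Nat.DivMod using (m/n≡1+[m∸n]/n)
open import Data.Bool using (Bool; true; false; _∧_; _∨_; not; T)
open import Data.Bool.Properties using (∧-assoc; ∧-identityʳ; ∧-zeroʳ; ∨-zeroʳ; T-∧; T-≡)
open import Data.List using (List; []; _∷_; length; filter; map; concatMap; _++_; applyUpTo; upTo)
open import Data.Product using (_×_; _,_; proj₁)
open import Data.Sum using (_⊎_; inj₁; inj₂)
open import Data.Unit using (tt)
open import Data.Empty using (⊥-elim)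
open import Function using (_∘_)
open import Function.Bundles using (Equivalence)
open import Relation.Binary.PropositionalEquality
  using (_≡_; _≢_; refl; sym; trans; cong; cong₂; subst; module ≡-Reasoning)
open import Relation.Binary.Definitions using (tri<; tri≈; tri>)
open import Relation.Nullary.Decidable using (T?; yes; no)
open import Algebra.Properties.CommutativeSemigroup +-commutativeSemigroup using (interchange)

-- The boolean comparisons on ℕ, as equations that `rewrite` can use.
≡ᵇ-true : ∀ {m n} → m ≡ n → (m ≡ᵇ n) ≡ true
≡ᵇ-true {m} {n} m≡n = Equivalence.to T-≡ (≡⇒≡ᵇ m n m≡n)

≡ᵇ-true⇒≡ : ∀ {m n} → (m ≡ᵇ n) ≡ true → m ≡ n
≡ᵇ-true⇒≡ {m} {n} e = ≡ᵇ⇒≡ m n (Equivalence.from T-≡ e)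

≡ᵇ-false⇒≢ : ∀ {m n} → (m ≡ᵇ n) ≡ false → m ≢ n
≡ᵇ-false⇒≢ {m} {n} e m≡n = subst T e (≡⇒≡ᵇ m n m≡n)

≡ᵇ-false : ∀ {m n} → m ≢ n → (m ≡ᵇ n) ≡ false
≡ᵇ-false {m} {n} m≢n with m ≡ᵇ n in e
... | true  = ⊥-elim (m≢n (≡ᵇ-true⇒≡ e))
... | false = refl

≤ᵇ-true : ∀ {m n} → m ≤ n → (m ≤ᵇ n) ≡ true
≤ᵇ-true m≤n = Equivalence.to T-≡ (≤⇒≤ᵇ m≤n)

≤ᵇ-false : ∀ {m n} → n < m → (m ≤ᵇ n) ≡ false
≤ᵇ-false {m} {n} n<m with m ≤ᵇ n in e
... | true  = ⊥-elim (<⇒≱ n<m (≤ᵇ⇒≤ m n (Equivalence.from T-≡ e)))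
... | false = refl

𝟙 : Bool → ℕ
𝟙 true  = 1
𝟙 false = 0

𝟙-∧ : ∀ b c → 𝟙 (b ∧ c) ≡ 𝟙 b * 𝟙 c
𝟙-∧ true  c = sym (+-identityʳ (𝟙 c))
𝟙-∧ false c = refl

𝟙-≡ᵇ-subst : ∀ (f : ℕ → ℕ) m k → f m * 𝟙 (m ≡ᵇ k) ≡ f k * 𝟙 (m ≡ᵇ k)
𝟙-≡ᵇ-subst f m k with m ≡ᵇ k in e
... | true  = cong (λ t → f t * 1) (≡ᵇ-true⇒≡ e)
... | false = trans (*-zeroʳ (f m)) (sym (*-zeroʳ (f k)))

private
  variable
    X Y : Set

sumOver : List X → (X → ℕ) → ℕ
sumOver []       f = 0
sumOver (x ∷ xs) f = f x + sumOver xs f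

sumOver-++ : (xs ys : List X) (f : X → ℕ) → sumOver (xs ++ ys) f ≡ sumOver xs f + sumOver ys f
sumOver-++ []       ys f = refl
sumOver-++ (x ∷ xs) ys f = trans (cong (f x +_) (sumOver-++ xs ys f)) (sym (+-assoc (f x) _ _))

sumOver-map : (g : X → Y) (xs : List X) (f : Y → ℕ) → sumOver (map g xs) f ≡ sumOver xs (f ∘ g)
sumOver-map g []       f = refl
sumOver-map g (x ∷ xs) f = cong (f (g x) +_) (sumOver-map g xs f)

sumOver-concatMap : (g : X → List Y) (xs : List X) (f : Y → ℕ) →
                    sumOver (concatMap g xs) f ≡ sumOver xs (λ x → sumOver (g x) f)
sumOver-concatMap g []       f = refl
sumOver-concatMap g (x ∷ xs) f =
  trans (sumOver-++ (g x) (concatMap g xs) f) (cong (sumOver (g x) f +_) (sumOver-concatMap g xs f))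

sumOver-cong : (xs : List X) {f g : X → ℕ} → (∀ x → f x ≡ g x) → sumOver xs f ≡ sumOver xs g
sumOver-cong []       f≗g = refl
sumOver-cong (x ∷ xs) f≗g = cong₂ _+_ (f≗g x) (sumOver-cong xs f≗g)

sumOver-+ : (xs : List X) (f g : X → ℕ) → sumOver xs (λ x → f x + g x) ≡ sumOver xs f + sumOver xs g
sumOver-+ []       f g = refl
sumOver-+ (x ∷ xs) f g =
  trans (cong (f x + g x +_) (sumOver-+ xs f g)) (interchange (f x) (g x) (sumOver xs f) (sumOver xs g))

sumOver-*ˡ : (xs : List X) (c : ℕ) (f : X → ℕ) → sumOver xs (λ x → c * f x) ≡ c * sumOver xs f
sumOver-*ˡ []       c f = sym (*-zeroʳ c)
sumOver-*ˡ (x ∷ xs) c f =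
  trans (cong (c * f x +_) (sumOver-*ˡ xs c f)) (sym (*-distribˡ-+ c (f x) (sumOver xs f)))

sumOver-zero : (xs : List X) → sumOver xs (λ _ → 0) ≡ 0
sumOver-zero []       = refl
sumOver-zero (x ∷ xs) = sumOver-zero xs

length-filter : (p : X → Bool) (xs : List X) → length (filter (T? ∘ p) xs) ≡ sumOver xs (𝟙 ∘ p)
length-filter p []       = refl
length-filter p (x ∷ xs) with p x
... | true  = cong suc (length-filter p xs)
... | false = length-filter p xs

-- Sums over a range: Σ< b f = Σ_{y < b} f y, recursing at the front so that
-- shifting the range by one (f ↦ f ∘ suc) is definitional.
Σ< : ℕ → (ℕ → ℕ) → ℕ
Σ< zero    f = 0
Σ< (suc b) f = f 0 + Σ< b (f ∘ suc)

Σ<-cong : ∀ b {f g : ℕ → ℕ} → (∀ y → f y ≡ g y) → Σ< b f ≡ Σ< b g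
Σ<-cong zero    f≗g = refl
Σ<-cong (suc b) f≗g = cong₂ _+_ (f≗g 0) (Σ<-cong b (f≗g ∘ suc))

Σ<-+ : ∀ b (f g : ℕ → ℕ) → Σ< b (λ y → f y + g y) ≡ Σ< b f + Σ< b g
Σ<-+ zero    f g = refl
Σ<-+ (suc b) f g =
  trans (cong (f 0 + g 0 +_) (Σ<-+ b (f ∘ suc) (g ∘ suc))) (interchange (f 0) (g 0) _ _)

Σ<-*ʳ : ∀ b (f : ℕ → ℕ) c → Σ< b (λ y → f y * c) ≡ Σ< b f * c
Σ<-*ʳ zero    f c = refl
Σ<-*ʳ (suc b) f c = trans (cong (f 0 * c +_) (Σ<-*ʳ b (f ∘ suc) c)) (sym (*-distribʳ-+ c (f 0) _))

Σ<-zero : ∀ b → Σ< b (λ _ → 0) ≡ 0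
Σ<-zero zero    = refl
Σ<-zero (suc b) = Σ<-zero b

sumOver-applyUpTo : ∀ (g : ℕ → ℕ) b (f : ℕ → ℕ) → sumOver (applyUpTo g b) f ≡ Σ< b (f ∘ g)
sumOver-applyUpTo g zero    f = refl
sumOver-applyUpTo g (suc b) f = cong (f (g 0) +_) (sumOver-applyUpTo (g ∘ suc) b f)

sumOver-letters : ∀ b (h : ℕ → ℕ) → sumOver (letters b) h ≡ Σ< b (h ∘ suc)
sumOver-letters b h = trans (sumOver-map suc (upTo b) h) (sumOver-applyUpTo (λ y → y) b (h ∘ suc))

Σ<-delta : ∀ b m → m < b → Σ< b (λ y → 𝟙 (y ≡ᵇ m)) ≡ 1
Σ<-delta (suc b) zero    _         = cong suc (Σ<-zero b)
Σ<-delta (suc b) (suc m) (s≤s m<b) = Σ<-delta b m m<b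

Σ<-restrict : ∀ b m (p : ℕ → Bool) → m ≤ b →
              Σ< b (λ y → 𝟙 (p y ∧ (suc y ≤ᵇ m))) ≡ Σ< m (𝟙 ∘ p)
Σ<-restrict b zero p _ =
  trans (Σ<-cong b (λ y → cong 𝟙 (∧-zeroʳ (p y)))) (Σ<-zero b)
Σ<-restrict (suc b) (suc m) p (s≤s m≤b) =
  cong₂ _+_ (cong 𝟙 (∧-identityʳ (p 0))) (Σ<-restrict b m (p ∘ suc) m≤b)

ceilHalf-suc-suc : ∀ n → ceilHalf (suc (suc n)) ≡ suc (ceilHalf n)
ceilHalf-suc-suc n = m/n≡1+[m∸n]/n {suc (suc (suc n))} {2} (s≤s (s≤s z≤n))

count-odd : ∀ m → Σ< m (λ y → 𝟙 (not (even (suc y)))) ≡ ceilHalf m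
count-odd zero          = refl
count-odd (suc zero)    = refl
count-odd (suc (suc m)) = trans (cong suc (count-odd m)) (sym (ceilHalf-suc-suc m))

maxLetter-snoc : ∀ w x → maxLetter (w ++ x ∷ []) ≡ maxLetter w ⊔ x
maxLetter-snoc []       x = ⊔-identityʳ x
maxLetter-snoc (y ∷ ys) x =
  trans (cong (y ⊔_) (maxLetter-snoc ys x)) (sym (⊔-assoc y (maxLetter ys) x))

rgFrom-snoc : ∀ m ws x → rgFrom m (ws ++ x ∷ []) ≡ rgFrom m ws ∧ ((1 ≤ᵇ x) ∧ (x ≤ᵇ suc (m ⊔ maxLetter ws)))
rgFrom-snoc m [] x rewrite ⊔-identityʳ m = cong ((1 ≤ᵇ x) ∧_) (∧-identityʳ (x ≤ᵇ suc m))
rgFrom-snoc m (z ∷ zs) x rewrite rgFrom-snoc (m ⊔ z) zs x | ⊔-assoc m z (maxLetter zs) =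
  sym (trans (∧-assoc (1 ≤ᵇ z) ((z ≤ᵇ suc m) ∧ rgFrom (m ⊔ z) zs) _)
             (cong ((1 ≤ᵇ z) ∧_) (∧-assoc (z ≤ᵇ suc m) (rgFrom (m ⊔ z) zs) _)))

isRG-snoc : ∀ w y → isRG (w ++ suc y ∷ []) ≡ isRG w ∧ (suc y ≤ᵇ suc (maxLetter w))
isRG-snoc []       zero    = refl
isRG-snoc []       (suc y) = refl
isRG-snoc (z ∷ zs) y rewrite rgFrom-snoc z zs (suc y) = sym (∧-assoc (z ≡ᵇ 1) (rgFrom z zs) _)

occ-snoc : ∀ z w x → occ z (w ++ x ∷ []) ≡ 𝟙 (z ≡ᵇ x) + occ z w
occ-snoc z [] x with z ≡ᵇ x
... | true  = refl
... | false = refl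
occ-snoc z (y ∷ ys) x with z ≡ᵇ y
... | true  = trans (cong suc (occ-snoc z ys x)) (sym (+-suc (𝟙 (z ≡ᵇ x)) (occ z ys)))
... | false = occ-snoc z ys x

occ-head : ∀ z zs → 1 ≤ occ z (z ∷ zs)
occ-head z zs rewrite ≡ᵇ-true (refl {x = z}) = s≤s z≤n

occ-tail : ∀ z y ys → occ z ys ≤ occ z (y ∷ ys)
occ-tail z y ys with z ≡ᵇ y
... | true  = n≤1+n _
... | false = ≤-refl

oddOrOnce : List ℕ → ℕ → Bool
oddOrOnce v x = not (even x) ∨ (occ x v ≡ᵇ 1)

allEvenOnce-snoc : ∀ v u x → allEvenOnce v (u ++ x ∷ []) ≡ allEvenOnce v u ∧ oddOrOnce v x
allEvenOnce-snoc v []       x = ∧-identityʳ (oddOrOnce v x)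
allEvenOnce-snoc v (z ∷ zs) x rewrite allEvenOnce-snoc v zs x =
  sym (∧-assoc (oddOrOnce v z) (allEvenOnce v zs) (oddOrOnce v x))

allEvenOnce-cong : ∀ v v′ u → (∀ z → 1 ≤ occ z u → oddOrOnce v z ≡ oddOrOnce v′ z) →
                   allEvenOnce v u ≡ allEvenOnce v′ u
allEvenOnce-cong v v′ []       same = refl
allEvenOnce-cong v v′ (z ∷ zs) same =
  cong₂ _∧_ (same z (occ-head z zs))
            (allEvenOnce-cong v v′ zs (λ z′ o → same z′ (≤-trans o (occ-tail z′ z zs))))

isRG⇒rgFrom₀ : ∀ w → T (isRG w) → T (rgFrom 0 w)
isRG⇒rgFrom₀ []                 _ = tt
isRG⇒rgFrom₀ (suc zero ∷ ys)    h = h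
isRG⇒rgFrom₀ (zero ∷ ys)        ()
isRG⇒rgFrom₀ (suc (suc _) ∷ ys) ()

rgFrom-step : ∀ m y ys → T (rgFrom m (y ∷ ys)) → y ≤ suc m × T (rgFrom (m ⊔ y) ys)
rgFrom-step m y ys h with Equivalence.to (T-∧ {1 ≤ᵇ y}) h
... | _ , h′ with Equivalence.to (T-∧ {y ≤ᵇ suc m}) h′
... | y≤ , rest = ≤ᵇ⇒≤ y (suc m) y≤ , rest

occ-above-max : ∀ z w → maxLetter w < z → occ z w ≡ 0
occ-above-max z []       _ = refl
occ-above-max z (y ∷ ys) max<z with z ≡ᵇ y in e
... | true  = ⊥-elim (<⇒≢ (≤-<-trans (m≤m⊔n y (maxLetter ys)) max<z) (sym (≡ᵇ-true⇒≡ e)))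
... | false = occ-above-max z ys (≤-<-trans (m≤n⊔m y (maxLetter ys)) max<z)

-- Letters grow by at most one at a time, so every value between the running
-- maximum m and the final maximum is attained.
rgFrom-occ : ∀ m ws z → T (rgFrom m ws) → m < z → z ≤ m ⊔ maxLetter ws → 1 ≤ occ z ws
rgFrom-occ m [] z _ m<z z≤m = ⊥-elim (<⇒≱ m<z (subst (z ≤_) (⊔-identityʳ m) z≤m))
rgFrom-occ m (y ∷ ys) z h m<z z≤max with z ≡ᵇ y in e | rgFrom-step m y ys h
... | true  | _          = s≤s z≤n
... | false | y≤m+1 , rest =
  rgFrom-occ (m ⊔ y) ys z rest (⊔-lub m<z y<z) (subst (z ≤_) (sym (⊔-assoc m y (maxLetter ys))) z≤max)
  where
  y<z : y < z
  y<z = ≤∧≢⇒< (≤-trans y≤m+1 m<z) (λ y≡z → ≡ᵇ-false⇒≢ e (sym y≡z))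

isRG-occ : ∀ w z → T (isRG w) → 1 ≤ z → z ≤ maxLetter w → 1 ≤ occ z w
isRG-occ w z h = rgFrom-occ 0 w z (isRG⇒rgFrom₀ w h)

rgFrom-length : ∀ m ws → T (rgFrom m ws) → m ⊔ maxLetter ws ≤ m + length ws
rgFrom-length m [] _ = ≤-reflexive (trans (⊔-identityʳ m) (sym (+-identityʳ m)))
rgFrom-length m (y ∷ ys) h with rgFrom-step m y ys h
... | y≤m+1 , rest = begin
  m ⊔ (y ⊔ maxLetter ys)       ≡⟨ ⊔-assoc m y (maxLetter ys) ⟨
  m ⊔ y ⊔ maxLetter ys         ≤⟨ rgFrom-length (m ⊔ y) ys rest ⟩
  m ⊔ y + length ys            ≤⟨ +-monoˡ-≤ (length ys) (⊔-lub (n≤1+n m) y≤m+1) ⟩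
  suc m + length ys            ≡⟨ +-suc m (length ys) ⟨
  m + suc (length ys)          ∎
  where open ≤-Reasoning

isRG-length : ∀ w → T (isRG w) → maxLetter w ≤ length w
isRG-length w h = rgFrom-length 0 w (isRG⇒rgFrom₀ w h)

extends : ℕ → ℕ → Bool
extends m x = (x ≡ᵇ suc m) ∨ (not (even x) ∧ (x ≤ᵇ m))

oddOrOnce-odd : ∀ v x → even x ≡ false → oddOrOnce v x ≡ true
oddOrOnce-odd v x odd rewrite odd = refl

oddOrOnce-snoc-other : ∀ w x z → z ≢ x → oddOrOnce (w ++ x ∷ []) z ≡ oddOrOnce w z
oddOrOnce-snoc-other w x z z≢x rewrite occ-snoc z w x | ≡ᵇ-false z≢x = refl

oddOrOnce-new-max : ∀ w → oddOrOnce (w ++ suc (maxLetter w) ∷ []) (suc (maxLetter w)) ≡ true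
oddOrOnce-new-max w
  rewrite occ-snoc (suc (maxLetter w)) w (suc (maxLetter w))
        | ≡ᵇ-true (refl {x = maxLetter w})
        | occ-above-max (suc (maxLetter w)) w ≤-refl = ∨-zeroʳ (not (even (suc (maxLetter w))))

oddOrOnce-repeat-even : ∀ w x → 1 ≤ occ x w → even x ≡ true → oddOrOnce (w ++ x ∷ []) x ≡ false
oddOrOnce-repeat-even w x occurs ev
  rewrite occ-snoc x w x | ≡ᵇ-true (refl {x = x}) | ev with occ x w | occurs
... | suc _ | _ = refl

allEvenOnce-snoc-stable : ∀ w x → occ x w ≡ 0 ⊎ even x ≡ false →
                          allEvenOnce (w ++ x ∷ []) w ≡ allEvenOnce w w
allEvenOnce-snoc-stable w x new-or-odd = allEvenOnce-cong (w ++ x ∷ []) w w (same new-or-odd)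
  where
  same : occ x w ≡ 0 ⊎ even x ≡ false → ∀ z → 1 ≤ occ z w → oddOrOnce (w ++ x ∷ []) z ≡ oddOrOnce w z
  same x-new-or-odd z occurs with z ≟ x | x-new-or-odd
  ... | no z≢x   | _          = oddOrOnce-snoc-other w x z z≢x
  ... | yes refl | inj₂ odd   = trans (oddOrOnce-odd (w ++ z ∷ []) z odd) (sym (oddOrOnce-odd w z odd))
  ... | yes refl | inj₁ absent with subst (1 ≤_) absent occurs
  ...   | ()

-- The three positions of the appended letter x relative to m = maxLetter w:
-- below or at m (allowed iff x is odd), equal to m+1 (allowed), above m+1 (not RG).
append-old : ∀ w x → T (isRG w) → 1 ≤ x → x ≤ maxLetter w →
             allEvenOnce (w ++ x ∷ []) w ∧ oddOrOnce (w ++ x ∷ []) x ≡ allEvenOnce w w ∧ not (even x)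
append-old w x rg 1≤x x≤m = by-parity (even x) refl
  where
  by-parity : ∀ b → even x ≡ b →
              allEvenOnce (w ++ x ∷ []) w ∧ oddOrOnce (w ++ x ∷ []) x ≡ allEvenOnce w w ∧ not b
  by-parity true  ev =
    trans (cong (allEvenOnce (w ++ x ∷ []) w ∧_) (oddOrOnce-repeat-even w x (isRG-occ w x rg 1≤x x≤m) ev))
          (trans (∧-zeroʳ _) (sym (∧-zeroʳ _)))
  by-parity false ev = cong₂ _∧_ (allEvenOnce-snoc-stable w x (inj₂ ev)) (oddOrOnce-odd (w ++ x ∷ []) x ev)

append-new : ∀ w → let x = suc (maxLetter w) in
             allEvenOnce (w ++ x ∷ []) w ∧ oddOrOnce (w ++ x ∷ []) x ≡ allEvenOnce w w ∧ true
append-new w = cong₂ _∧_ (allEvenOnce-snoc-stable w _ (inj₁ (occ-above-max _ w ≤-refl))) (oddOrOnce-new-max w)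

isAllowable-snoc : ∀ w y → isAllowable (w ++ suc y ∷ []) ≡ isAllowable w ∧ extends (maxLetter w) (suc y)
isAllowable-snoc w y =
  trans (cong₂ _∧_ (isRG-snoc w y) (allEvenOnce-snoc (w ++ suc y ∷ []) w (suc y))) by-position
  where
  by-position : (isRG w ∧ (suc y ≤ᵇ suc (maxLetter w))) ∧
                  (allEvenOnce (w ++ suc y ∷ []) w ∧ oddOrOnce (w ++ suc y ∷ []) (suc y))
                ≡ (isRG w ∧ allEvenOnce w w) ∧ extends (maxLetter w) (suc y)
  by-position with isRG w in rg
  ... | false = refl
  ... | true with <-cmp (suc y) (suc (maxLetter w))
  ... | tri< x<m+1 _ _
      rewrite ≤ᵇ-true (<⇒≤ x<m+1) | ≡ᵇ-false (<⇒≢ x<m+1) | ≤ᵇ-true (≤-pred x<m+1) =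
        trans (append-old w (suc y) (Equivalence.from T-≡ rg) (s≤s z≤n) (≤-pred x<m+1))
              (cong (allEvenOnce w w ∧_) (sym (∧-identityʳ _)))
  ... | tri≈ _ refl _
      rewrite ≤ᵇ-true (≤-refl {suc y}) | ≡ᵇ-true (refl {x = y}) = append-new w
  ... | tri> _ _ m+1<x
      rewrite ≤ᵇ-false m+1<x | ≡ᵇ-false (>⇒≢ m+1<x) | ≤ᵇ-false (<-trans (n<1+n _) m+1<x)
            | ∧-zeroʳ (not (even (suc y))) = sym (∧-zeroʳ _)

χ : ℕ → List ℕ → ℕ
χ k w = 𝟙 (isAllowable w ∧ (maxLetter w ≡ᵇ k))

extends-split : ∀ m x k → 𝟙 (extends m x ∧ ((m ⊔ x) ≡ᵇ k))
              ≡ 𝟙 (x ≡ᵇ suc m) * 𝟙 (suc m ≡ᵇ k) + 𝟙 (not (even x) ∧ (x ≤ᵇ m)) * 𝟙 (m ≡ᵇ k)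
extends-split m x k with <-cmp x (suc m)
... | tri< x<m+1 _ _
    rewrite ≡ᵇ-false (<⇒≢ x<m+1) | ≤ᵇ-true (≤-pred x<m+1) | m≥n⇒m⊔n≡m (≤-pred x<m+1)
          | ∧-identityʳ (not (even x)) = 𝟙-∧ (not (even x)) (m ≡ᵇ k)
... | tri≈ _ refl _
    rewrite ≡ᵇ-true (refl {x = m}) | ≤ᵇ-false (≤-refl {suc m}) | m≤n⇒m⊔n≡n (n≤1+n m)
          | ∧-zeroʳ (not (even (suc m))) = sym (trans (+-identityʳ _) (*-identityˡ _))
... | tri> _ _ m+1<x
    rewrite ≡ᵇ-false (>⇒≢ m+1<x) | ≤ᵇ-false (<-trans (n<1+n m) m+1<x)
          | ∧-zeroʳ (not (even x)) = refl

count-extensions : ∀ b m k → m < b →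
                   Σ< b (λ y → 𝟙 (extends m (suc y) ∧ ((m ⊔ suc y) ≡ᵇ k)))
                   ≡ 𝟙 (suc m ≡ᵇ k) + ceilHalf k * 𝟙 (m ≡ᵇ k)
count-extensions b m k m<b = begin
  Σ< b (λ y → 𝟙 (extends m (suc y) ∧ ((m ⊔ suc y) ≡ᵇ k)))
    ≡⟨ Σ<-cong b (λ y → extends-split m (suc y) k) ⟩
  Σ< b (λ y → new y * 𝟙 (suc m ≡ᵇ k) + old y * 𝟙 (m ≡ᵇ k))
    ≡⟨ Σ<-+ b _ _ ⟩
  Σ< b (λ y → new y * 𝟙 (suc m ≡ᵇ k)) + Σ< b (λ y → old y * 𝟙 (m ≡ᵇ k))
    ≡⟨ cong₂ _+_ (Σ<-*ʳ b new _) (Σ<-*ʳ b old _) ⟩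
  Σ< b new * 𝟙 (suc m ≡ᵇ k) + Σ< b old * 𝟙 (m ≡ᵇ k)
    ≡⟨ cong₂ (λ s t → s * 𝟙 (suc m ≡ᵇ k) + t * 𝟙 (m ≡ᵇ k)) (Σ<-delta b m m<b) old-count ⟩
  1 * 𝟙 (suc m ≡ᵇ k) + ceilHalf m * 𝟙 (m ≡ᵇ k)
    ≡⟨ cong₂ _+_ (*-identityˡ _) (𝟙-≡ᵇ-subst ceilHalf m k) ⟩
  𝟙 (suc m ≡ᵇ k) + ceilHalf k * 𝟙 (m ≡ᵇ k) ∎
  where
  open ≡-Reasoning
  new old : ℕ → ℕ
  new y = 𝟙 (y ≡ᵇ m)
  old y = 𝟙 (not (even (suc y)) ∧ (suc y ≤ᵇ m))
  old-count : Σ< b old ≡ ceilHalf m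
  old-count = trans (Σ<-restrict b m (λ y → not (even (suc y))) (<⇒≤ m<b)) (count-odd m)

-- What a word w contributes, through all its one-letter extensions, to the
-- count of allowable words with maximum k.
extensionWeight : ℕ → List ℕ → ℕ
extensionWeight zero    w = 0
extensionWeight (suc j) w = χ j w + ceilHalf (suc j) * χ (suc j) w

sum-extensions : ∀ b k w → (T (isAllowable w) → maxLetter w < b) →
                 sumOver (letters b) (λ x → χ k (w ++ x ∷ [])) ≡ extensionWeight k w
sum-extensions b k w bound = begin
  sumOver (letters b) (λ x → χ k (w ++ x ∷ []))  ≡⟨ sumOver-letters b _ ⟩
  Σ< b (λ y → χ k (w ++ suc y ∷ []))              ≡⟨ Σ<-cong b χ-snoc ⟩
  Σ< b (λ y → 𝟙 (isAllowable w ∧ E y))            ≡⟨ by-allowability (isAllowable w) refl ⟩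
  extensionWeight k w                              ∎
  where
  open ≡-Reasoning
  m = maxLetter w
  E : ℕ → Bool
  E y = extends m (suc y) ∧ ((m ⊔ suc y) ≡ᵇ k)
  χ-snoc : ∀ y → χ k (w ++ suc y ∷ []) ≡ 𝟙 (isAllowable w ∧ E y)
  χ-snoc y rewrite isAllowable-snoc w y | maxLetter-snoc w (suc y) = cong 𝟙 (∧-assoc (isAllowable w) _ _)
  by-allowability : ∀ al → isAllowable w ≡ al → Σ< b (λ y → 𝟙 (al ∧ E y)) ≡ extensionWeight k w
  by-allowability false e = trans (Σ<-zero b) (sym (no-weight k))
    where
    no-weight : ∀ k → extensionWeight k w ≡ 0
    no-weight zero    = refl
    no-weight (suc j) rewrite e = *-zeroʳ (ceilHalf (suc j))
  by-allowability true e = trans (count-extensions b m k (bound (Equivalence.from T-≡ e))) (weight k)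
    where
    weight : ∀ k → 𝟙 (suc m ≡ᵇ k) + ceilHalf k * 𝟙 (m ≡ᵇ k) ≡ extensionWeight k w
    weight zero    = refl
    weight (suc j) rewrite e = refl

ΣW : ℕ → ℕ → (List ℕ → ℕ) → ℕ
ΣW b n f = sumOver (wordsOver b n) f

ΣW-cons : ∀ b n f → ΣW b (suc n) f ≡ sumOver (letters b) (λ x → ΣW b n (λ w → f (x ∷ w)))
ΣW-cons b n f =
  trans (sumOver-concatMap (λ x → map (x ∷_) (wordsOver b n)) (letters b) f)
        (sumOver-cong (letters b) (λ x → sumOver-map (x ∷_) (wordsOver b n) f))

ΣW-cong : ∀ b n (f g : List ℕ → ℕ) → (∀ w → length w ≡ n → f w ≡ g w) → ΣW b n f ≡ ΣW b n g
ΣW-cong b zero    f g f≗g = cong (_+ 0) (f≗g [] refl)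
ΣW-cong b (suc n) f g f≗g = begin
  ΣW b (suc n) f                                        ≡⟨ ΣW-cons b n f ⟩
  sumOver (letters b) (λ x → ΣW b n (λ w → f (x ∷ w)))
    ≡⟨ sumOver-cong (letters b) (λ x → ΣW-cong b n _ _ (λ w |w| → f≗g (x ∷ w) (cong suc |w|))) ⟩
  sumOver (letters b) (λ x → ΣW b n (λ w → g (x ∷ w)))  ≡⟨ ΣW-cons b n g ⟨
  ΣW b (suc n) g                                        ∎
  where open ≡-Reasoning

ΣW-snoc : ∀ b n f → ΣW b (suc n) f ≡ ΣW b n (λ w → sumOver (letters b) (λ x → f (w ++ x ∷ [])))
ΣW-snoc b zero f =
  trans (ΣW-cons b zero f)
        (trans (sumOver-cong (letters b) (λ x → +-identityʳ (f (x ∷ [])))) (sym (+-identityʳ _)))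
ΣW-snoc b (suc n) f = begin
  ΣW b (suc (suc n)) f
    ≡⟨ ΣW-cons b (suc n) f ⟩
  sumOver (letters b) (λ x → ΣW b (suc n) (λ w → f (x ∷ w)))
    ≡⟨ sumOver-cong (letters b) (λ x → ΣW-snoc b n (λ w → f (x ∷ w))) ⟩
  sumOver (letters b) (λ x → ΣW b n (λ w → sumOver (letters b) (λ z → f (x ∷ w ++ z ∷ []))))
    ≡⟨ ΣW-cons b n _ ⟨
  ΣW b (suc n) (λ w → sumOver (letters b) (λ z → f (w ++ z ∷ [])))
    ∎
  where open ≡-Reasoning

A : ℕ → ℕ → ℕ
A zero    zero    = 1
A zero    (suc k) = 0
A (suc n) zero    = 0
A (suc n) (suc k) = A n k + ceilHalf (suc k) * A n (suc k)

A-vanishes : ∀ n k → n < k → A n k ≡ 0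
A-vanishes zero    (suc k) _         = refl
A-vanishes (suc n) (suc k) (s≤s n<k)
  rewrite A-vanishes n k n<k | A-vanishes n (suc k) (m<n⇒m<1+n n<k) = *-zeroʳ (ceilHalf (suc k))

count-allowable : ∀ b n k → n ≤ b → ΣW b n (χ k) ≡ A n k
count-allowable b zero    zero    _   = refl
count-allowable b zero    (suc k) _   = refl
count-allowable b (suc n) k       n<b = begin
  ΣW b (suc n) (χ k)                                              ≡⟨ ΣW-snoc b n (χ k) ⟩
  ΣW b n (λ w → sumOver (letters b) (λ x → χ k (w ++ x ∷ [])))
    ≡⟨ ΣW-cong b n _ _ (λ w |w| → sum-extensions b k w (max<b w |w|)) ⟩
  ΣW b n (extensionWeight k)                                      ≡⟨ sum-weights k ⟩
  A (suc n) k                                                     ∎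
  where
  open ≡-Reasoning
  max<b : ∀ w → length w ≡ n → T (isAllowable w) → maxLetter w < b
  max<b w |w| al =
    ≤-<-trans (subst (maxLetter w ≤_) |w| (isRG-length w (proj₁ (Equivalence.to T-∧ al)))) n<b
  sum-weights : ∀ k → ΣW b n (extensionWeight k) ≡ A (suc n) k
  sum-weights zero    = sumOver-zero (wordsOver b n)
  sum-weights (suc j) =
    trans (sumOver-+ (wordsOver b n) (χ j) _)
          (cong₂ _+_ (count-allowable b n j (<⇒≤ n<b))
                     (trans (sumOver-*ˡ (wordsOver b n) (ceilHalf (suc j)) (χ (suc j)))
                            (cong (ceilHalf (suc j) *_) (count-allowable b n (suc j) (<⇒≤ n<b)))))

a≡A : ∀ n k → a n k ≡ A n k
a≡A n k = trans (length-filter (λ w → isAllowable w ∧ (maxLetter w ≡ᵇ k)) (wordsOver n n))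
                (count-allowable n n k ≤-refl)

proposition3p3 : ((n k : ℕ) → 1 ≤ n → 1 ≤ k → k ≤ n →
                   a n k ≡ a (n ∸ 1) (k ∸ 1) + ceilHalf k * a (n ∸ 1) k)
                 × (a 0 0 ≡ 1)
                 × ((n : ℕ) → 1 ≤ n → a n 0 ≡ 0)
                 × ((n k : ℕ) → n < k → a n k ≡ 0)
proposition3p3 = recurrence , a≡A 0 0 , (λ { (suc n) _ → a≡A (suc n) 0 }) ,
                 (λ n k n<k → trans (a≡A n k) (A-vanishes n k n<k))
  where
  recurrence : (n k : ℕ) → 1 ≤ n → 1 ≤ k → k ≤ n → a n k ≡ a (n ∸ 1) (k ∸ 1) + ceilHalf k * a (n ∸ 1) k
  recurrence (suc n) (suc k) _ _ _ rewrite a≡A (suc n) (suc k) | a≡A n k | a≡A n (suc k) = refl
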